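{- Let $G_1\subsetneq G_2\subsetneq\dots\subsetneq G_r$ be a sequence of distinct graphs on a common finite vertex set, each contained in the next (as edge sets). For indices $i\in\{1,\dots,r\}$, call $j>i$ a right-neighbor of $i$ if $G_j\setminus G_i$ is a clique, and call $j<i$ a left-neighbor of $i$ if $G_i\setminus G_j$ is a clique. Then for every $y$ with $1\le y$ and $y+2\le r$, it is not the case that each of $y$, $y+1$, $y+2$ has at least three right-neighbors and at least three left-neighbors.
   Context: Graphs are simple graphs on a common vertex set, identified with their edge sets; $G\subset H$ means the edge set of $G$ is contained in that of $H$, and $H\setminus G$ denotes the set of edges of $H$ not in $G$. A set of edges $E$ is called a clique if there is a set $S$ of at least two vertices such that $E$ is exactly the set of all pairs of distinct vertices of $S$. -}

module Defs where

open import Data.Nat using (ℕ; _<_; _≤_; _+_)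
open import Data.Fin using (Fin)
open import Data.Fin.Subset using (Subset; _∈_; ∣_∣)
open import Data.Bool using (Bool; true; false)
open import Data.Product using (_×_; ∃; ∃-syntax; Σ-syntax)
open import Relation.Binary.PropositionalEquality using (_≡_; _≢_)
open import Relation.Nullary using (¬_)
open import Function.Bundles using (_⇔_)

record Graph (n : ℕ) : Set where
  field
    adj   : Fin n → Fin n → Bool
    sym   : ∀ u v → adj u v ≡ adj v u
    irrfl : ∀ u → adj u u ≡ false
open Graph public

EdgeSet : ℕ → Set₁
EdgeSet n = Fin n → Fin n → Set

edges : ∀ {n} → Graph n → EdgeSet n
edges G u v = adj G u v ≡ true

_⊆ᴳ_ : ∀ {n} → Graph n → Graph n → Set
G ⊆ᴳ H = ∀ u v → adj G u v ≡ true → adj H u v ≡ true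

_⊊ᴳ_ : ∀ {n} → Graph n → Graph n → Set
G ⊊ᴳ H = (G ⊆ᴳ H) × (∃[ u ] ∃[ v ] (adj H u v ≡ true × adj G u v ≡ false))

_∖ᴳ_ : ∀ {n} → Graph n → Graph n → EdgeSet n
(H ∖ᴳ G) u v = (adj H u v ≡ true) × (adj G u v ≡ false)

IsClique : ∀ {n} → EdgeSet n → Set
IsClique {n} E = ∃[ S ] ((2 ≤ ∣ S ∣) × (∀ u v → E u v ⇔ ((u ≢ v) × (u ∈ S) × (v ∈ S))))

-- Chains G₁ ⊊ G₂ ⊊ ... ⊊ G_r, indexed 1..r (values outside are irrelevant).
IsChain : ∀ {n} → (r : ℕ) → (ℕ → Graph n) → Set
IsChain r G = ∀ i j → 1 ≤ i → i < j → j ≤ r → G i ⊊ᴳ G j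

RightNbr : ∀ {n} → ℕ → (ℕ → Graph n) → ℕ → ℕ → Set
RightNbr r G i j = (i < j) × (j ≤ r) × IsClique (G j ∖ᴳ G i)

LeftNbr : ∀ {n} → ℕ → (ℕ → Graph n) → ℕ → ℕ → Set
LeftNbr r G i j = (1 ≤ j) × (j < i) × IsClique (G i ∖ᴳ G j)

AtLeast3 : (ℕ → Set) → Set
AtLeast3 P = ∃[ a ] ∃[ b ] ∃[ c ] ((a ≢ b) × (a ≢ c) × (b ≢ c) × P a × P b × P c)

Rich : ∀ {n} → ℕ → (ℕ → Graph n) → ℕ → Set
Rich r G i = AtLeast3 (RightNbr r G i) × AtLeast3 (LeftNbr r G i)

-- If G ⊆ H ⊊ K ⊆ L, then K ∖ H is the intersection of K ∖ G and L ∖ H, and a nonempty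
-- intersection of two cliques is a clique.  If G ⊆ H ⊆ K, then K ∖ G is the edge-disjoint
-- union of H ∖ G and K ∖ H, and an edge-disjoint union of two cliques is never a clique:
-- it misses the edge between a vertex only of the first and a vertex only of the second.
-- Were y, y+1, y+2 all rich, each would have a left and a right neighbour lying outside
-- {y, y+1, y+2}; the first fact then makes G_{y+1} ∖ G_y, G_{y+2} ∖ G_{y+1} and
-- G_{y+2} ∖ G_y all cliques, contradicting the second.
module Submission where

open import Defs hiding (sym)
open import Data.Bool using (true; false) renaming (_≟_ to _≟ᵇ_)
open import Data.Bool.Properties using (not-¬; ¬-not)
open import Data.Empty using (⊥)
open import Data.Fin using (zero; suc) renaming (_≟_ to _≟ᶠ_)
open import Data.Fin.Properties using (suc-injective)
open import Data.Fin.Subset using (Subset; _∈_; _∉_; _⊆_; ∣_∣; _∩_; ⁅_⁆; Nonempty; inside; outside)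
open import Data.Fin.Subset.Properties
  using (x∈p∩q⁺; x∈p∩q⁻; _∈?_; ∣⁅x⁆∣≡1; x∈⁅y⁆⇒x≡y; p⊂q⇒∣p∣<∣q∣)
open import Data.Nat using (ℕ; _≤_; _<_; _+_; _≟_; suc; s≤s; s≤s⁻¹)
open import Data.Nat.Properties using (≤-trans; <-trans; <-≤-trans; <⇒≤; n<1+n; ≤∧≢⇒<; +-comm)
open import Data.Product using (_×_; _,_; proj₁; proj₂; ∃-syntax; map; map₂; swap)
open import Data.Sum using (_⊎_; inj₁; inj₂)
open import Data.Vec using (_∷_; here; there)
open import Function using (_∘_; flip)
open import Function.Bundles using (_⇔_; mk⇔; Equivalence)
open import Relation.Binary.PropositionalEquality using (_≡_; _≢_; refl; sym; subst; ≢-sym)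
open import Relation.Nullary using (¬_; yes; no; contradiction)

open Equivalence

1≤∣p∣⇒Nonempty : ∀ {n} (p : Subset n) → 1 ≤ ∣ p ∣ → Nonempty p
1≤∣p∣⇒Nonempty (inside ∷ p)  _      = zero , here
1≤∣p∣⇒Nonempty (outside ∷ p) 1≤∣p∣ = map suc there (1≤∣p∣⇒Nonempty p 1≤∣p∣)

2≤∣p∣⇒two-members : ∀ {n} (p : Subset n) → 2 ≤ ∣ p ∣ → ∃[ u ] ∃[ v ] (u ≢ v × u ∈ p × v ∈ p)
2≤∣p∣⇒two-members (inside ∷ p) (s≤s 1≤∣p∣) with 1≤∣p∣⇒Nonempty p 1≤∣p∣
... | v , v∈p = zero , suc v , (λ ()) , here , there v∈p
2≤∣p∣⇒two-members (outside ∷ p) 2≤∣p∣ with 2≤∣p∣⇒two-members p 2≤∣p∣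
... | u , v , u≢v , u∈p , v∈p = suc u , suc v , u≢v ∘ suc-injective , there u∈p , there v∈p

2≤∣p∣⇒other-member : ∀ {n} {p : Subset n} → 2 ≤ ∣ p ∣ → ∀ {x} → x ∈ p → ∃[ y ] (x ≢ y × y ∈ p)
2≤∣p∣⇒other-member {p = p} 2≤∣p∣ {x} _ with 2≤∣p∣⇒two-members p 2≤∣p∣
... | u , v , u≢v , u∈p , v∈p with x ≟ᶠ u
...   | yes refl = v , u≢v , v∈p
...   | no x≢u   = u , x≢u , u∈p

two-members⇒2≤∣p∣ : ∀ {n} {p : Subset n} {u v} → u ≢ v → u ∈ p → v ∈ p → 2 ≤ ∣ p ∣
two-members⇒2≤∣p∣ {p = p} {u} {v} u≢v u∈p v∈p =
  subst (_< ∣ p ∣) (∣⁅x⁆∣≡1 u) (p⊂q⇒∣p∣<∣q∣ (⁅u⁆⊆p , v , v∈p , v∉⁅u⁆))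
  where
  ⁅u⁆⊆p : ⁅ u ⁆ ⊆ p
  ⁅u⁆⊆p x∈⁅u⁆ = subst (_∈ p) (sym (x∈⁅y⁆⇒x≡y u x∈⁅u⁆)) u∈p
  v∉⁅u⁆ : v ∉ ⁅ u ⁆
  v∉⁅u⁆ = ≢-sym u≢v ∘ x∈⁅y⁆⇒x≡y u

module _ {n : ℕ} where

  IsCliqueOn : Subset n → EdgeSet n → Set
  IsCliqueOn S E = ∀ u v → E u v ⇔ ((u ≢ v) × (u ∈ S) × (v ∈ S))

  ∩-isClique : ∀ {D E F : EdgeSet n} → IsClique E → IsClique F →
               (∀ u v → D u v ⇔ (E u v × F u v)) → ∀ {u v} → D u v → IsClique D
  ∩-isClique {D} (A , _ , E≡K[A]) (B , _ , F≡K[B]) D≡E∩F {u} {v} Duv =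
    A ∩ B , 2≤∣A∩B∣ , λ x y → mk⇔ (D⇒K x y) (K⇒D x y)
    where
    D⇒K : ∀ x y → D x y → (x ≢ y) × (x ∈ A ∩ B) × (y ∈ A ∩ B)
    D⇒K x y Dxy with to (D≡E∩F x y) Dxy
    ... | Exy , Fxy with to (E≡K[A] x y) Exy | to (F≡K[B] x y) Fxy
    ... | x≢y , x∈A , y∈A | _ , x∈B , y∈B = x≢y , x∈p∩q⁺ (x∈A , x∈B) , x∈p∩q⁺ (y∈A , y∈B)
    K⇒D : ∀ x y → (x ≢ y) × (x ∈ A ∩ B) × (y ∈ A ∩ B) → D x y
    K⇒D x y (x≢y , x∈A∩B , y∈A∩B) with x∈p∩q⁻ A B x∈A∩B | x∈p∩q⁻ A B y∈A∩B
    ... | x∈A , x∈B | y∈A , y∈B =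
      from (D≡E∩F x y) (from (E≡K[A] x y) (x≢y , x∈A , y∈A) , from (F≡K[B] x y) (x≢y , x∈B , y∈B))
    2≤∣A∩B∣ : 2 ≤ ∣ A ∩ B ∣
    2≤∣A∩B∣ with D⇒K u v Duv
    ... | u≢v , u∈A∩B , v∈A∩B = two-members⇒2≤∣p∣ u≢v u∈A∩B v∈A∩B

  isCliqueOn-⊆ : ∀ {A S} {E D : EdgeSet n} → IsCliqueOn A E → 2 ≤ ∣ A ∣ → IsCliqueOn S D →
                 (∀ {u v} → E u v → D u v) → A ⊆ S
  isCliqueOn-⊆ E≡K[A] 2≤∣A∣ D≡K[S] E⊆D {x} x∈A with 2≤∣p∣⇒other-member 2≤∣A∣ x∈A
  ... | y , x≢y , y∈A = proj₁ (proj₂ (to (D≡K[S] x y) (E⊆D (from (E≡K[A] x y) (x≢y , x∈A , y∈A)))))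

  edge-disjoint⇒⊈ : ∀ {A B} {E F : EdgeSet n} → IsCliqueOn A E → 2 ≤ ∣ A ∣ → IsCliqueOn B F →
                    (∀ u v → E u v → F u v → ⊥) → ∃[ a ] (a ∈ A × a ∉ B)
  edge-disjoint⇒⊈ {A} {B} E≡K[A] 2≤∣A∣ F≡K[B] E∩F≡∅ with 2≤∣p∣⇒two-members A 2≤∣A∣
  ... | u , v , u≢v , u∈A , v∈A with u ∈? B | v ∈? B
  ...   | no u∉B  | _       = u , u∈A , u∉B
  ...   | yes _   | no v∉B  = v , v∈A , v∉B
  ...   | yes u∈B | yes v∈B =
    contradiction (from (F≡K[B] u v) (u≢v , u∈B , v∈B)) (E∩F≡∅ u v (from (E≡K[A] u v) (u≢v , u∈A , v∈A)))

  edge-disjoint-∪-¬isClique : ∀ {D E F : EdgeSet n} → IsClique E → IsClique F →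
                              (∀ u v → E u v → F u v → ⊥) →
                              (∀ u v → D u v ⇔ (E u v ⊎ F u v)) → ¬ IsClique D
  edge-disjoint-∪-¬isClique (A , 2≤∣A∣ , E≡K[A]) (B , 2≤∣B∣ , F≡K[B]) E∩F≡∅ D≡E∪F (S , _ , D≡K[S])
    with edge-disjoint⇒⊈ E≡K[A] 2≤∣A∣ F≡K[B] E∩F≡∅
       | edge-disjoint⇒⊈ F≡K[B] 2≤∣B∣ E≡K[A] (λ u v → flip (E∩F≡∅ u v))
  ... | a , a∈A , a∉B | b , b∈B , b∉A
    with to (D≡E∪F a b) (from (D≡K[S] a b) (a≢b , A⊆S a∈A , B⊆S b∈B))
    where
    a≢b : a ≢ b
    a≢b refl = b∉A a∈A
    A⊆S : A ⊆ S
    A⊆S = isCliqueOn-⊆ E≡K[A] 2≤∣A∣ D≡K[S] (from (D≡E∪F _ _) ∘ inj₁)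
    B⊆S : B ⊆ S
    B⊆S = isCliqueOn-⊆ F≡K[B] 2≤∣B∣ D≡K[S] (from (D≡E∪F _ _) ∘ inj₂)
  ... | inj₁ Eab = b∉A (proj₂ (proj₂ (to (E≡K[A] a b) Eab)))
  ... | inj₂ Fab = a∉B (proj₁ (proj₂ (to (F≡K[B] a b) Fab)))

-- _⊆ᴳ_ and _∖ᴳ_ do not determine their graph arguments, so these are named at call sites.
private variable
  m : ℕ
  G H K L : Graph m

contraposeᵇ : ∀ {a b} → (a ≡ true → b ≡ true) → b ≡ false → a ≡ false
contraposeᵇ {a} a⇒b b≡false with a ≟ᵇ true
... | yes a≡true = contradiction b≡false (not-¬ (a⇒b a≡true))
... | no a≢true = ¬-not a≢true

∖ᴳ-∩ : G ⊆ᴳ H → K ⊆ᴳ L → ∀ u v → (K ∖ᴳ H) u v ⇔ ((K ∖ᴳ G) u v × (L ∖ᴳ H) u v)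
∖ᴳ-∩ G⊆H K⊆L u v = mk⇔
  (λ (K[uv] , H[uv]) → (K[uv] , contraposeᵇ (G⊆H u v) H[uv]) , (K⊆L u v K[uv] , H[uv]))
  (λ ((K[uv] , _) , (_ , H[uv])) → K[uv] , H[uv])

∖ᴳ-∪ : G ⊆ᴳ H → H ⊆ᴳ K → ∀ u v → (K ∖ᴳ G) u v ⇔ ((H ∖ᴳ G) u v ⊎ (K ∖ᴳ H) u v)
∖ᴳ-∪ {G = G} {H = H} {K = K} G⊆H H⊆K u v = mk⇔ split join
  where
  split : (K ∖ᴳ G) u v → (H ∖ᴳ G) u v ⊎ (K ∖ᴳ H) u v
  split (K[uv] , G[uv]) with adj H u v ≟ᵇ true
  ... | yes H[uv] = inj₁ (H[uv] , G[uv])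
  ... | no ¬H[uv] = inj₂ (K[uv] , ¬-not ¬H[uv])
  join : (H ∖ᴳ G) u v ⊎ (K ∖ᴳ H) u v → (K ∖ᴳ G) u v
  join (inj₁ (H[uv] , G[uv])) = H⊆K u v H[uv] , G[uv]
  join (inj₂ (K[uv] , H[uv])) = K[uv] , contraposeᵇ (G⊆H u v) H[uv]

∖ᴳ-disjoint : ∀ u v → (H ∖ᴳ G) u v → (K ∖ᴳ H) u v → ⊥
∖ᴳ-disjoint u v (H[uv] , _) (_ , ¬H[uv]) = not-¬ H[uv] ¬H[uv]

∖ᴳ-isClique-shrink : G ⊆ᴳ H → H ⊊ᴳ K → K ⊆ᴳ L →
                     IsClique (K ∖ᴳ G) → IsClique (L ∖ᴳ H) → IsClique (K ∖ᴳ H)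
∖ᴳ-isClique-shrink {G = G} {H = H} {K = K} {L = L} G⊆H (_ , _ , _ , new-edge) K⊆L K∖G L∖H =
  ∩-isClique K∖G L∖H (∖ᴳ-∩ {G = G} {H = H} {K = K} {L = L} G⊆H K⊆L) new-edge

∖ᴳ-isClique-¬additive : G ⊆ᴳ H → H ⊆ᴳ K →
                        IsClique (H ∖ᴳ G) → IsClique (K ∖ᴳ H) → ¬ IsClique (K ∖ᴳ G)
∖ᴳ-isClique-¬additive {G = G} {H = H} {K = K} G⊆H H⊆K H∖G K∖H =
  edge-disjoint-∪-¬isClique H∖G K∖H (∖ᴳ-disjoint {H = H} {G = G} {K = K})
                            (∖ᴳ-∪ {G = G} {H = H} {K = K} G⊆H H⊆K)

two-avoiding : ∀ {P : ℕ → Set} {b c p} → b ≢ c → P b → P c → b ≢ p → c ≢ p →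
               ∀ q → ∃[ x ] (P x × x ≢ p × x ≢ q)
two-avoiding {b = b} b≢c Pb Pc b≢p c≢p q with b ≟ q
... | yes refl = _ , Pc , c≢p , ≢-sym b≢c
... | no b≢q   = b , Pb , b≢p , b≢q

AtLeast3⇒avoiding : ∀ {P : ℕ → Set} → AtLeast3 P → ∀ p q → ∃[ x ] (P x × x ≢ p × x ≢ q)
AtLeast3⇒avoiding (a , b , c , a≢b , a≢c , b≢c , Pa , Pb , Pc) p q with a ≟ p | a ≟ q
... | yes refl | _        = two-avoiding b≢c Pb Pc (≢-sym a≢b) (≢-sym a≢c) q
... | no _     | yes refl = map₂ (map₂ swap) (two-avoiding b≢c Pb Pc (≢-sym a≢b) (≢-sym a≢c) p)
... | no a≢p   | no a≢q   = a , Pa , a≢p , a≢q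

<∧≢⇒suc< : ∀ {m k} → m < k → k ≢ suc m → suc m < k
<∧≢⇒suc< m<k k≢1+m = ≤∧≢⇒< m<k (≢-sym k≢1+m)

<suc∧≢⇒< : ∀ {j m} → j < suc m → j ≢ m → j < m
<suc∧≢⇒< j<1+m j≢m = ≤∧≢⇒< (s≤s⁻¹ j<1+m) j≢m

module _ {n r : ℕ} {G : ℕ → Graph n} (chain : IsChain r G) where

  chain-⊆ : ∀ {i j} → 1 ≤ i → i < j → j ≤ r → G i ⊆ᴳ G j
  chain-⊆ 1≤i i<j j≤r = proj₁ (chain _ _ 1≤i i<j j≤r)

  isClique-between : ∀ {j a b k} → 1 ≤ j → j < a → a < b → b < k → k ≤ r →
                     IsClique (G b ∖ᴳ G j) → IsClique (G k ∖ᴳ G a) → IsClique (G b ∖ᴳ G a)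
  isClique-between {j} {a} {b} {k} 1≤j j<a a<b b<k k≤r =
    ∖ᴳ-isClique-shrink {G = G j} {H = G a} {K = G b} {L = G k}
      (chain-⊆ 1≤j j<a (<⇒≤ a<r)) (chain _ _ 1≤a a<b (<⇒≤ b<r)) (chain-⊆ (≤-trans 1≤a (<⇒≤ a<b)) b<k k≤r)
    where
    1≤a : 1 ≤ a
    1≤a = ≤-trans 1≤j (<⇒≤ j<a)
    b<r : b < r
    b<r = <-≤-trans b<k k≤r
    a<r : a < r
    a<r = <-trans a<b b<r

  ¬isClique-triangle : ∀ {a b c} → 1 ≤ a → a < b → b < c → c ≤ r →
                       IsClique (G b ∖ᴳ G a) → IsClique (G c ∖ᴳ G b) → ¬ IsClique (G c ∖ᴳ G a)
  ¬isClique-triangle {a} {b} {c} 1≤a a<b b<c c≤r =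
    ∖ᴳ-isClique-¬additive {G = G a} {H = G b} {K = G c}
      (chain-⊆ 1≤a a<b (<⇒≤ (<-≤-trans b<c c≤r))) (chain-⊆ (≤-trans 1≤a (<⇒≤ a<b)) b<c c≤r)

  consecutive-¬Rich : ∀ y → 1 ≤ y → suc (suc y) ≤ r →
                      ¬ (Rich r G y × Rich r G (suc y) × Rich r G (suc (suc y)))
  consecutive-¬Rich y 1≤y y+2≤r ((right₀ , _) , (right₁ , left₁) , (_ , left₂))
    with AtLeast3⇒avoiding right₀ (suc y) (suc (suc y))
       | AtLeast3⇒avoiding right₁ (suc (suc y)) (suc (suc y))
       | AtLeast3⇒avoiding left₁ y y
       | AtLeast3⇒avoiding left₂ (suc y) (suc y)
       | AtLeast3⇒avoiding left₂ y (suc y)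
  ... | k₀ , (y<k₀ , k₀≤r , C[k₀∖y]) , k₀≢y+1 , k₀≢y+2
      | k₁ , (y+1<k₁ , k₁≤r , C[k₁∖y+1]) , k₁≢y+2 , _
      | j₁ , (1≤j₁ , j₁<y+1 , C[y+1∖j₁]) , j₁≢y , _
      | j₂ , (1≤j₂ , j₂<y+2 , C[y+2∖j₂]) , j₂≢y+1 , _
      | j₂′ , (1≤j₂′ , j₂′<y+2 , C[y+2∖j₂′]) , j₂′≢y , j₂′≢y+1 =
    ¬isClique-triangle 1≤y (n<1+n y) (n<1+n (suc y)) y+2≤r
      (isClique-between 1≤j₁ (<suc∧≢⇒< j₁<y+1 j₁≢y) (n<1+n y) y+1<k₀ k₀≤r C[y+1∖j₁] C[k₀∖y])
      (isClique-between 1≤j₂ (<suc∧≢⇒< j₂<y+2 j₂≢y+1) (n<1+n (suc y))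
                        (<∧≢⇒suc< y+1<k₁ k₁≢y+2) k₁≤r C[y+2∖j₂] C[k₁∖y+1])
      (isClique-between 1≤j₂′ (<suc∧≢⇒< (<suc∧≢⇒< j₂′<y+2 j₂′≢y+1) j₂′≢y)
                        (<-trans (n<1+n y) (n<1+n (suc y)))
                        (<∧≢⇒suc< y+1<k₀ k₀≢y+2) k₀≤r C[y+2∖j₂′] C[k₀∖y])
    where
    y+1<k₀ : suc y < k₀
    y+1<k₀ = <∧≢⇒suc< y<k₀ k₀≢y+1

lemma2 : (n r : ℕ) (G : ℕ → Graph n) → IsChain r G →
    (y : ℕ) → 1 ≤ y → y + 2 ≤ r →
    ¬ (Rich r G y × Rich r G (y + 1) × Rich r G (y + 2))
lemma2 n r G chain y 1≤y y+2≤r (rich₀ , rich₁ , rich₂) =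
  consecutive-¬Rich {G = G} chain y 1≤y (subst (_≤ r) (+-comm y 2) y+2≤r)
    (rich₀ , subst (Rich r G) (+-comm y 1) rich₁ , subst (Rich r G) (+-comm y 2) rich₂)
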